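{- Let $G=(V,E)$ be a hypergraph and $e\in E$. Then \[ I(G,x)=I(G_{ -e},x)-x^{|e|-1}\cdot I(G_{/e},x)+x^{|e|-1}\cdot I(G_{ -V(e)},x), \] where $G_{ -V(e)}$ denotes the deletion of all vertices of $e$.
   Context: A hypergraph $G=(V,E)$ consists of a finite vertex set $V$ and a finite multiset $E$ of non-empty subsets of $V$ (edges). A set $W\subseteq V$ is independent in $G$ if no edge $f\in E$ satisfies $f\subseteq W$; the independence polynomial is $I(G,x)=\sum_{W\subseteq V,\ W\text{ independent}}x^{|W|}$. $G_{ -e}$ is obtained by removing the edge $e$ (one occurrence) from $E$. $G_{/e}$ (contraction) is obtained by removing $e$ and identifying all vertices of $e$ into a single new vertex $w$ (every other edge containing vertices of $e$ has them replaced by $w$). $G_{ -V(e)}$ is obtained by deleting all vertices of $e$ together with all edges containing at least one of them. -}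

module Defs where

open import Data.Nat using (ℕ; zero; suc; _∸_; _<ᵇ_)
open import Data.Bool using (Bool; true; false; if_then_else_)
open import Data.Integer using (ℤ; +_; 0ℤ)
import Data.Integer
open import Data.Fin using (Fin)
open import Data.Vec using (Vec; []; _∷_)
open import Data.List using (List; []; _∷_; length; filter; map; _++_; removeAt; lookup)
open import Data.List.Relation.Unary.All using (All; all?)
open import Data.Product using (_×_)
open import Data.Fin.Subset using (Subset; _⊆_; _∩_; _─_; ∣_∣; Nonempty)
open import Data.Fin.Subset.Properties using (_⊆?_; nonempty?)
open import Relation.Nullary using (¬_; Dec; yes; no; _×-dec_; ¬?)
open import Relation.Nullary.Decidable using (does)
open import Relation.Binary.PropositionalEquality using (_≡_)
import Data.Nat.Properties as ℕP

-- A hypergraph on the ambient type Fin n: vertex set V ⊆ Fin n,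
-- and a multiset (list) of edges, each a subset of Fin n.
record Hypergraph : Set where
  constructor hg
  field
    n : ℕ
    V : Subset n
    E : List (Subset n)
open Hypergraph public

IsHypergraph : Hypergraph → Set
IsHypergraph G = All (λ f → Nonempty f × f ⊆ V G) (E G)

allSubsets : (n : ℕ) → List (Subset n)
allSubsets zero = [] ∷ []
allSubsets (suc n) = map (false ∷_) (allSubsets n) ++ map (true ∷_) (allSubsets n)

Independent : (G : Hypergraph) → Subset (n G) → Set
Independent G W = All (λ f → ¬ (f ⊆ W)) (E G)

independent? : (G : Hypergraph) (W : Subset (n G)) → Dec (Independent G W)
independent? G W = all? (λ f → ¬? (f ⊆? W)) (E G)

Poly : Set
Poly = ℕ → ℤ

_≗ₚ_ : Poly → Poly → Set
p ≗ₚ q = ∀ k → p k ≡ q k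

infixl 6 _+ₚ_ _-ₚ_
_+ₚ_ : Poly → Poly → Poly
(p +ₚ q) k = p k Data.Integer.+ q k

_-ₚ_ : Poly → Poly → Poly
(p -ₚ q) k = p k Data.Integer.- q k

xpow*_ : ℕ → Poly → Poly
(xpow* m) p k = if k <ᵇ m then 0ℤ else p (k ∸ m)

indPoly : Hypergraph → Poly
indPoly G k = + length (filter (λ W → (W ⊆? V G) ×-dec (independent? G W ×-dec (∣ W ∣ ℕP.≟ k))) (allSubsets (n G)))

deleteEdge : (G : Hypergraph) → Fin (length (E G)) → Hypergraph
deleteEdge (hg n V E) i = hg n V (removeAt E i)

deleteVerticesOf : (G : Hypergraph) → Fin (length (E G)) → Hypergraph
deleteVerticesOf (hg n V E) i =
  hg n (V ─ lookup E i) (filter (λ f → ¬? (nonempty? (f ∩ lookup E i))) E)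

-- Contraction G_{/e}: remove the edge, identify the vertices of e into a
-- new vertex w.  The new ambient set is Fin (suc n), with w = zero and the
-- old vertex v represented by suc v.
liftContract : ∀ {n} → Subset n → Subset n → Subset (suc n)
liftContract e f = does (nonempty? (f ∩ e)) ∷ (f ─ e)

contract : (G : Hypergraph) → Fin (length (E G)) → Hypergraph
contract (hg n V E) i =
  hg (suc n) (true ∷ (V ─ lookup E i)) (map (liftContract (lookup E i)) (removeAt E i))

edge : (G : Hypergraph) → Fin (length (E G)) → Subset (n G)
edge G i = lookup (E G) i

-- Let B count the independent sets of G₋ₑ that contain e.  The others are exactly the
-- independent sets of G, so I(G₋ₑ) = I(G) + B.  The independent sets of G/ₑ avoiding the
-- new vertex w are those of G₋V(e), while {w} ∪ U is independent in G/ₑ iff U ∪ e is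
-- independent in G₋ₑ (for U disjoint from e); this lowers sizes by |e| − 1, so
-- I(G/ₑ) = I(G₋V(e)) + x^{1−|e|} B.  Eliminating B gives the identity.
module Submission where

open import Algebra using (CommutativeMonoid)
open import Data.Bool using (Bool; true; false; _∧_; _∨_; not; T; if_then_else_)
open import Data.Bool.Properties using (∧-assoc; ∧-zeroʳ; ∧-commutativeMonoid; T-≡)
open import Data.Bool.ListAction using (and; all)
open import Data.Fin using (Fin; zero; suc)
open import Data.Fin.Subset using (Subset; _∩_; _∪_; _─_; ∣_∣; Nonempty)
open import Data.Fin.Subset.Properties using (_⊆?_; nonempty?; ∩-idem; p⊆q⇒∣p∣≤∣q∣)
import Data.Integer as ℤ
import Data.Integer.Properties as ℤₚ
open import Data.Integer.Solver using (module +-*-Solver)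
open import Data.List using (List; []; _∷_; length; filter; map; _++_; removeAt; lookup)
open import Data.List.Membership.Propositional.Properties using (∈-lookup)
open import Data.List.Properties using (filter-++; length-++; map-∘; map-cong)
import Data.List.Relation.Unary.All as All
open import Data.Nat using (ℕ; zero; suc; _+_; _∸_; _≤_; _<_; _<ᵇ_; s≤s; z≤n)
open import Data.Nat.Properties using (_≟_; +-commutativeSemigroup; +-suc; +-identityʳ; m+n∸n≡m; m∸n+n≡m; <⇒≱; ≤-trans; ≤-reflexive; m∸n≤m; <ᵇ⇒<; ≮⇒≥; <⇒<ᵇ)
open import Data.Product using (_,_; proj₁; proj₂)
open import Data.Vec using ([]; _∷_; here; there)
open import Defs
open import Level using (0ℓ)
open import Function using (_∘_; _⇔_; mk⇔; Equivalence)
open import Relation.Binary.PropositionalEquality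
open ≡-Reasoning
open import Relation.Nullary using (¬_; Dec; does; ¬?; yes; no)
open import Relation.Nullary.Decidable using (dec-true; dec-false; does-⇔)
open import Relation.Unary using (Pred; Decidable)

open import Algebra.Properties.CommutativeSemigroup
  (CommutativeMonoid.commutativeSemigroup ∧-commutativeMonoid) using () renaming (x∙yz≈y∙xz to ∧-swapˡ)
open import Algebra.Properties.CommutativeSemigroup +-commutativeSemigroup
  using () renaming (interchange to +-interchange)

countSubsets : ∀ n → (Subset n → Bool) → ℕ
countSubsets zero    P = if P [] then 1 else 0
countSubsets (suc n) P = countSubsets n (P ∘ (false ∷_)) + countSubsets n (P ∘ (true ∷_))

length-filter-map : ∀ {A B : Set} {P : Pred B 0ℓ} (P? : Decidable P) (f : A → B) xs →
                    length (filter P? (map f xs)) ≡ length (filter (P? ∘ f) xs)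
length-filter-map P? f []       = refl
length-filter-map P? f (x ∷ xs) with does (P? (f x))
... | true  = cong suc (length-filter-map P? f xs)
... | false = length-filter-map P? f xs

length-filter-allSubsets : ∀ {n} {P : Pred (Subset n) 0ℓ} (P? : Decidable P) →
                           length (filter P? (allSubsets n)) ≡ countSubsets n (does ∘ P?)
length-filter-allSubsets {zero} P? with does (P? [])
... | true  = refl
... | false = refl
length-filter-allSubsets {suc n} P? = begin
  length (filter P? (map (false ∷_) subsets ++ map (true ∷_) subsets))
    ≡⟨ cong length (filter-++ P? (map (false ∷_) subsets) _) ⟩
  length (filter P? (map (false ∷_) subsets) ++ filter P? (map (true ∷_) subsets))
    ≡⟨ length-++ (filter P? (map (false ∷_) subsets)) ⟩
  length (filter P? (map (false ∷_) subsets)) + length (filter P? (map (true ∷_) subsets))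
    ≡⟨ cong₂ _+_ (length-filter-map P? (false ∷_) subsets) (length-filter-map P? (true ∷_) subsets) ⟩
  length (filter (P? ∘ (false ∷_)) subsets) + length (filter (P? ∘ (true ∷_)) subsets)
    ≡⟨ cong₂ _+_ (length-filter-allSubsets (P? ∘ (false ∷_))) (length-filter-allSubsets (P? ∘ (true ∷_))) ⟩
  countSubsets (suc n) (does ∘ P?) ∎
  where subsets = allSubsets n

countSubsets-cong : ∀ n {P Q : Subset n → Bool} → (∀ W → P W ≡ Q W) → countSubsets n P ≡ countSubsets n Q
countSubsets-cong zero    P≗Q = cong (λ b → if b then 1 else 0) (P≗Q [])
countSubsets-cong (suc n) P≗Q =
  cong₂ _+_ (countSubsets-cong n (P≗Q ∘ (false ∷_))) (countSubsets-cong n (P≗Q ∘ (true ∷_)))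

countSubsets-false : ∀ n {P : Subset n → Bool} → (∀ W → P W ≡ false) → countSubsets n P ≡ 0
countSubsets-false zero    P≗false rewrite P≗false [] = refl
countSubsets-false (suc n) P≗false =
  cong₂ _+_ (countSubsets-false n (P≗false ∘ (false ∷_))) (countSubsets-false n (P≗false ∘ (true ∷_)))

countSubsets-split : ∀ n (Q P : Subset n → Bool) →
  countSubsets n P ≡ countSubsets n (λ W → not (Q W) ∧ P W) + countSubsets n (λ W → Q W ∧ P W)
countSubsets-split zero Q P with Q [] | P []
... | true  | true  = refl
... | true  | false = refl
... | false | true  = refl
... | false | false = refl
countSubsets-split (suc n) Q P =
  trans (cong₂ _+_ (countSubsets-split n (Q ∘ (false ∷_)) (P ∘ (false ∷_)))
                   (countSubsets-split n (Q ∘ (true ∷_)) (P ∘ (true ∷_))))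
        (+-interchange (restrict false P∧¬Q) (restrict false P∧Q) (restrict true P∧¬Q) (restrict true P∧Q))
  where
  restrict : Bool → (Subset (suc n) → Bool) → ℕ
  restrict b R = countSubsets n (R ∘ (b ∷_))
  P∧¬Q P∧Q : Subset (suc n) → Bool
  P∧¬Q W = not (Q W) ∧ P W
  P∧Q W = Q W ∧ P W

infix 8 _⊆ᵇ_ _meets_

_⊆ᵇ_ : ∀ {n} → Subset n → Subset n → Bool
p ⊆ᵇ q = does (p ⊆? q)

-- Unlike does (nonempty? (p ∩ q)), this computes on _∷_; nonempty?-∩ identifies the two.
_meets_ : ∀ {n} → Subset n → Subset n → Bool
[]      meets []      = false
(b ∷ p) meets (c ∷ q) = b ∧ c ∨ p meets q

nonempty?-outside : ∀ {n} (p : Subset n) → does (nonempty? (false ∷ p)) ≡ does (nonempty? p)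
nonempty?-outside p = does-⇔ (mk⇔ drop (λ (i , i∈p) → suc i , there i∈p)) (nonempty? (false ∷ p)) (nonempty? p)
  where
  drop : Nonempty (false ∷ p) → Nonempty p
  drop (suc i , there i∈p) = i , i∈p

nonempty?-∩ : ∀ {n} (p q : Subset n) → does (nonempty? (p ∩ q)) ≡ p meets q
nonempty?-∩ []          []          = refl
nonempty?-∩ (true ∷ p)  (true ∷ q)  = refl
nonempty?-∩ (true ∷ p)  (false ∷ q) = trans (nonempty?-outside (p ∩ q)) (nonempty?-∩ p q)
nonempty?-∩ (false ∷ p) (c ∷ q)     = trans (nonempty?-outside (p ∩ q)) (nonempty?-∩ p q)

-- W ↦ W ─ e is a bijection from the supersets of e onto the sets disjoint from e.
countSubsets-shift : ∀ n (e : Subset n) (P : Subset n → Bool) →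
  countSubsets n (λ W → e ⊆ᵇ W ∧ P W) ≡ countSubsets n (λ U → not (U meets e) ∧ P (U ∪ e))
countSubsets-shift zero    []          P = refl
countSubsets-shift (suc n) (false ∷ e) P =
  cong₂ _+_ (countSubsets-shift n e (P ∘ (false ∷_))) (countSubsets-shift n e (P ∘ (true ∷_)))
countSubsets-shift (suc n) (true ∷ e)  P = begin
  countSubsets n (λ _ → false) + containing ≡⟨ cong (_+ containing) (countSubsets-false n λ _ → refl) ⟩
  containing                                ≡⟨ countSubsets-shift n e (P ∘ (true ∷_)) ⟩
  disjoint                                  ≡⟨ +-identityʳ disjoint ⟨
  disjoint + 0                              ≡⟨ cong (disjoint +_) (countSubsets-false n λ _ → refl) ⟨
  disjoint + countSubsets n (λ _ → false)   ∎
  where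
  containing disjoint : ℕ
  containing = countSubsets n (λ W → e ⊆ᵇ W ∧ P (true ∷ W))
  disjoint   = countSubsets n (λ U → not (U meets e) ∧ P (true ∷ (U ∪ e)))

nonempty⇒∣p∣>0 : ∀ {n} {p : Subset n} → Nonempty p → 0 < ∣ p ∣
nonempty⇒∣p∣>0 {p = true ∷ p}  _                 = s≤s z≤n
nonempty⇒∣p∣>0 {p = false ∷ p} (suc i , there i∈p) = nonempty⇒∣p∣>0 (i , i∈p)

meets-refl : ∀ {n} (p : Subset n) → Nonempty p → p meets p ≡ true
meets-refl p p≢∅ = begin
  p meets p                  ≡⟨ nonempty?-∩ p p ⟨
  does (nonempty? (p ∩ p))   ≡⟨ cong (does ∘ nonempty?) (∩-idem p) ⟩
  does (nonempty? p)         ≡⟨ dec-true (nonempty? p) p≢∅ ⟩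
  true                       ∎

─-disjoint : ∀ {n} (p q : Subset n) → p meets q ≡ false → p ─ q ≡ p
─-disjoint []          []          _ = refl
─-disjoint (true ∷ p)  (false ∷ q) h = cong (true ∷_) (─-disjoint p q h)
─-disjoint (false ∷ p) (true ∷ q)  h = cong (false ∷_) (─-disjoint p q h)
─-disjoint (false ∷ p) (false ∷ q) h = cong (false ∷_) (─-disjoint p q h)

⊆ᵇ-─-disjoint : ∀ {n} (p q r : Subset n) → p ⊆ᵇ (r ─ q) ≡ true → p meets q ≡ false
⊆ᵇ-─-disjoint []          []          []          _ = refl
⊆ᵇ-─-disjoint (false ∷ p) (c ∷ q)     (_ ∷ r)     h = ⊆ᵇ-─-disjoint p q r h
⊆ᵇ-─-disjoint (true ∷ p)  (false ∷ q) (true ∷ r)  h = ⊆ᵇ-─-disjoint p q r h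

⊆ᵇ-∪ : ∀ {n} (f p q : Subset n) → f ⊆ᵇ (p ∪ q) ≡ (f ─ q) ⊆ᵇ p
⊆ᵇ-∪ []          []          []          = refl
⊆ᵇ-∪ (false ∷ f) (_ ∷ p)     (true ∷ q)  = ⊆ᵇ-∪ f p q
⊆ᵇ-∪ (false ∷ f) (_ ∷ p)     (false ∷ q) = ⊆ᵇ-∪ f p q
⊆ᵇ-∪ (true ∷ f)  (true ∷ p)  (true ∷ q)  = ⊆ᵇ-∪ f p q
⊆ᵇ-∪ (true ∷ f)  (true ∷ p)  (false ∷ q) = ⊆ᵇ-∪ f p q
⊆ᵇ-∪ (true ∷ f)  (false ∷ p) (true ∷ q)  = ⊆ᵇ-∪ f p q
⊆ᵇ-∪ (true ∷ f)  (false ∷ p) (false ∷ q) = refl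

∪-⊆ᵇ-disjoint : ∀ {n} (p q r : Subset n) → q ⊆ᵇ r ≡ true →
                not (p meets q) ∧ (p ∪ q) ⊆ᵇ r ≡ p ⊆ᵇ (r ─ q)
∪-⊆ᵇ-disjoint []          []          []          _ = refl
∪-⊆ᵇ-disjoint (true ∷ p)  (true ∷ q)  (true ∷ r)  _ = refl
∪-⊆ᵇ-disjoint (false ∷ p) (true ∷ q)  (true ∷ r)  h = ∪-⊆ᵇ-disjoint p q r h
∪-⊆ᵇ-disjoint (false ∷ p) (false ∷ q) (_ ∷ r)     h = ∪-⊆ᵇ-disjoint p q r h
∪-⊆ᵇ-disjoint (true ∷ p)  (false ∷ q) (true ∷ r)  h = ∪-⊆ᵇ-disjoint p q r h
∪-⊆ᵇ-disjoint (true ∷ p)  (false ∷ q) (false ∷ r) h = ∧-zeroʳ (not (p meets q))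

∣∪∣-disjoint : ∀ {n} (p q : Subset n) → p meets q ≡ false → ∣ p ∪ q ∣ ≡ ∣ p ∣ + ∣ q ∣
∣∪∣-disjoint []          []          _ = refl
∣∪∣-disjoint (true ∷ p)  (false ∷ q) h = cong suc (∣∪∣-disjoint p q h)
∣∪∣-disjoint (false ∷ p) (true ∷ q)  h = trans (cong suc (∣∪∣-disjoint p q h)) (sym (+-suc ∣ p ∣ ∣ q ∣))
∣∪∣-disjoint (false ∷ p) (false ∷ q) h = ∣∪∣-disjoint p q h

∷-⊆ᵇ-inside : ∀ {n} b (p q : Subset n) → (b ∷ p) ⊆ᵇ (true ∷ q) ≡ p ⊆ᵇ q
∷-⊆ᵇ-inside true  p q = refl
∷-⊆ᵇ-inside false p q = refl

m+n≡o⇔m≡o∸n : ∀ {m n o} → n ≤ o → (m + n ≡ o) ⇔ (m ≡ o ∸ n)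
m+n≡o⇔m≡o∸n {m} {n} n≤o =
  mk⇔ (λ m+n≡o → trans (sym (m+n∸n≡m m n)) (cong (_∸ n) m+n≡o))
      (λ m≡o∸n → trans (cong (_+ n) m≡o∸n) (m∸n+n≡m n≤o))

∧-cong-when : ∀ a {b c} → (a ≡ true → b ≡ c) → a ∧ b ≡ a ∧ c
∧-cong-when true  b≡c = b≡c refl
∧-cong-when false _   = refl

all-cong : ∀ {A : Set} {p q : A → Bool} → (∀ x → p x ≡ q x) → ∀ xs → all p xs ≡ all q xs
all-cong p≗q xs = cong and (map-cong p≗q xs)

all-map : ∀ {A B : Set} (p : B → Bool) (f : A → B) xs → all p (map f xs) ≡ all (p ∘ f) xs
all-map p f xs = cong and (sym (map-∘ xs))

all-filter : ∀ {A : Set} {Q : Pred A 0ℓ} (p : A → Bool) (Q? : Decidable Q) xs →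
             all p (filter Q? xs) ≡ all (λ x → not (does (Q? x)) ∨ p x) xs
all-filter p Q? []       = refl
all-filter p Q? (x ∷ xs) with does (Q? x)
... | true  = cong (p x ∧_) (all-filter p Q? xs)
... | false = all-filter p Q? xs

all-removeAt : ∀ {A : Set} (p : A → Bool) xs (i : Fin (length xs)) →
               all p xs ≡ p (lookup xs i) ∧ all p (removeAt xs i)
all-removeAt p (x ∷ xs) zero    = refl
all-removeAt p (x ∷ xs) (suc i) =
  trans (cong (p x ∧_) (all-removeAt p xs i)) (∧-swapˡ (p x) (p (lookup xs i)) _)

independentᵇ : ∀ {n} → List (Subset n) → Subset n → Bool
independentᵇ Es W = all (λ f → not (f ⊆ᵇ W)) Es

hasSize : ∀ {n} → ℕ → Subset n → Bool
hasSize k W = does (∣ W ∣ ≟ k)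

independentCount : ∀ n → Subset n → List (Subset n) → ℕ → ℕ
independentCount n V Es k = countSubsets n (λ W → W ⊆ᵇ V ∧ independentᵇ Es W ∧ hasSize k W)

does-independent? : ∀ {n} Es (W : Subset n) → does (All.all? (λ f → ¬? (f ⊆? W)) Es) ≡ independentᵇ Es W
does-independent? []       W = refl
does-independent? (f ∷ Es) W = cong (not (f ⊆ᵇ W) ∧_) (does-independent? Es W)

indPoly-independentCount : ∀ n V Es k → indPoly (hg n V Es) k ≡ ℤ.+ independentCount n V Es k
indPoly-independentCount n V Es k =
  cong ℤ.+_ (trans (length-filter-allSubsets {n} _)
                   (countSubsets-cong n λ W → cong (λ b → W ⊆ᵇ V ∧ b ∧ hasSize k W) (does-independent? Es W)))

a≡a+b-[c+b]+c : ∀ (a b c : ℤ.ℤ) → a ≡ a ℤ.+ b ℤ.- (c ℤ.+ b) ℤ.+ c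
a≡a+b-[c+b]+c = solve 3 (λ a b c → a := a :+ b :- (c :+ b) :+ c) refl
  where open +-*-Solver

module _ (n : ℕ) (V : Subset n) (E : List (Subset n)) (i : Fin (length E))
         (wf : IsHypergraph (hg n V E)) where

  private
    G : Hypergraph
    G = hg n V E

    e : Subset n
    e = edge G i

    E₋ₑ : List (Subset n)
    E₋ₑ = removeAt E i

    d : ℕ
    d = ∣ e ∣ ∸ 1

    e-nonempty : Nonempty e
    e-nonempty = proj₁ (All.lookup wf (∈-lookup i))

    e⊆ᵇV : e ⊆ᵇ V ≡ true
    e⊆ᵇV = dec-true (e ⊆? V) (proj₂ (All.lookup wf (∈-lookup i)))

    ∣e∣≡1+d : ∣ e ∣ ≡ suc d
    ∣e∣≡1+d with ∣ e ∣ | nonempty⇒∣p∣>0 e-nonempty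
    ... | suc _ | _ = refl

    independentIn₋ₑ : ℕ → Subset n → Bool
    independentIn₋ₑ k W = W ⊆ᵇ V ∧ independentᵇ E₋ₑ W ∧ hasSize k W

  containingEdge : ℕ → ℕ
  containingEdge k = countSubsets n (λ W → e ⊆ᵇ W ∧ independentIn₋ₑ k W)

  deleteEdge-count : ∀ k → independentCount n V E₋ₑ k ≡ independentCount n V E k + containingEdge k
  deleteEdge-count k =
    trans (countSubsets-split n (e ⊆ᵇ_) (independentIn₋ₑ k))
          (cong (_+ containingEdge k) (countSubsets-cong n avoiding-e))
    where
    avoiding-e : ∀ W → not (e ⊆ᵇ W) ∧ independentIn₋ₑ k W ≡ W ⊆ᵇ V ∧ independentᵇ E W ∧ hasSize k W
    avoiding-e W = begin
      not (e ⊆ᵇ W) ∧ W ⊆ᵇ V ∧ independentᵇ E₋ₑ W ∧ hasSize k W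
        ≡⟨ ∧-swapˡ (not (e ⊆ᵇ W)) (W ⊆ᵇ V) _ ⟩
      W ⊆ᵇ V ∧ not (e ⊆ᵇ W) ∧ independentᵇ E₋ₑ W ∧ hasSize k W
        ≡⟨ cong (W ⊆ᵇ V ∧_) (∧-assoc (not (e ⊆ᵇ W)) _ _) ⟨
      W ⊆ᵇ V ∧ (not (e ⊆ᵇ W) ∧ independentᵇ E₋ₑ W) ∧ hasSize k W
        ≡⟨ cong (λ b → W ⊆ᵇ V ∧ b ∧ hasSize k W) (all-removeAt (λ f → not (f ⊆ᵇ W)) E i) ⟨
      W ⊆ᵇ V ∧ independentᵇ E W ∧ hasSize k W ∎

  containingEdge-small : ∀ {k} → k < ∣ e ∣ → containingEdge k ≡ 0
  containingEdge-small {k} k<∣e∣ = countSubsets-false n too-small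
    where
    too-small : ∀ W → e ⊆ᵇ W ∧ independentIn₋ₑ k W ≡ false
    too-small W with e ⊆? W
    ... | no _    = refl
    ... | yes e⊆W = begin
      W ⊆ᵇ V ∧ independentᵇ E₋ₑ W ∧ hasSize k W
        ≡⟨ cong (λ b → W ⊆ᵇ V ∧ independentᵇ E₋ₑ W ∧ b) (dec-false (∣ W ∣ ≟ k) ∣W∣≢k) ⟩
      W ⊆ᵇ V ∧ independentᵇ E₋ₑ W ∧ false
        ≡⟨ cong (W ⊆ᵇ V ∧_) (∧-zeroʳ _) ⟩
      W ⊆ᵇ V ∧ false
        ≡⟨ ∧-zeroʳ _ ⟩
      false ∎
      where
      ∣W∣≢k : ¬ ∣ W ∣ ≡ k
      ∣W∣≢k ∣W∣≡k = <⇒≱ k<∣e∣ (≤-trans (p⊆q⇒∣p∣≤∣q∣ e⊆W) (≤-reflexive ∣W∣≡k))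

  private
    lift : Subset n → Subset (suc n)
    lift = liftContract e

    avoids-e : (f : Subset n) → Dec (¬ Nonempty (f ∩ e))
    avoids-e f = ¬? (nonempty? (f ∩ e))

    independent-avoiding-w : ∀ U → independentᵇ (map lift E₋ₑ) (false ∷ U) ≡ independentᵇ (filter avoids-e E) U
    independent-avoiding-w U = begin
      independentᵇ (map lift E₋ₑ) (false ∷ U)     ≡⟨ all-map _ lift E₋ₑ ⟩
      all (λ f → not (lift f ⊆ᵇ (false ∷ U))) E₋ₑ ≡⟨ all-cong lifted E₋ₑ ⟩
      all avoids-or-⊈ E₋ₑ                         ≡⟨ cong (_∧ all avoids-or-⊈ E₋ₑ) e-avoids-or-⊈ ⟨
      avoids-or-⊈ e ∧ all avoids-or-⊈ E₋ₑ         ≡⟨ all-removeAt avoids-or-⊈ E i ⟨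
      all avoids-or-⊈ E                           ≡⟨ all-filter _ avoids-e E ⟨
      independentᵇ (filter avoids-e E) U          ∎
      where
      avoids-or-⊈ : Subset n → Bool
      avoids-or-⊈ f = not (does (avoids-e f)) ∨ not (f ⊆ᵇ U)

      e-avoids-or-⊈ : avoids-or-⊈ e ≡ true
      e-avoids-or-⊈ = cong (λ b → not (not b) ∨ not (e ⊆ᵇ U)) (trans (nonempty?-∩ e e) (meets-refl e e-nonempty))

      lifted : ∀ f → not (lift f ⊆ᵇ (false ∷ U)) ≡ avoids-or-⊈ f
      lifted f with does (nonempty? (f ∩ e)) in f∩e
      ... | true  = refl
      ... | false = cong (λ p → not (p ⊆ᵇ U)) (─-disjoint f e (trans (sym (nonempty?-∩ f e)) f∩e))

    independent-through-w : ∀ U → independentᵇ E₋ₑ (U ∪ e) ≡ independentᵇ (map lift E₋ₑ) (true ∷ U)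
    independent-through-w U =
      trans (all-cong (λ f → cong not (trans (⊆ᵇ-∪ f U e) (sym (∷-⊆ᵇ-inside (does (nonempty? (f ∩ e))) (f ─ e) U)))) E₋ₑ)
            (sym (all-map _ lift E₋ₑ))

    hasSize-through-w : ∀ {k} → d ≤ k → ∀ U → U meets e ≡ false → hasSize k (U ∪ e) ≡ hasSize (k ∸ d) (true ∷ U)
    hasSize-through-w {k} d≤k U U∩e≡∅ = begin
      does (∣ U ∪ e ∣ ≟ k)       ≡⟨ cong (λ s → does (s ≟ k)) ∣U∪e∣≡1+∣U∣+d ⟩
      does (suc ∣ U ∣ + d ≟ k)   ≡⟨ does-⇔ (m+n≡o⇔m≡o∸n d≤k) (suc ∣ U ∣ + d ≟ k) (suc ∣ U ∣ ≟ k ∸ d) ⟩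
      does (suc ∣ U ∣ ≟ k ∸ d)   ∎
      where
      ∣U∪e∣≡1+∣U∣+d : ∣ U ∪ e ∣ ≡ suc ∣ U ∣ + d
      ∣U∪e∣≡1+∣U∣+d = trans (∣∪∣-disjoint U e U∩e≡∅) (trans (cong (∣ U ∣ +_) ∣e∣≡1+d) (+-suc ∣ U ∣ d))

    through-w : ∀ {k} → d ≤ k → ∀ U →
      not (U meets e) ∧ independentIn₋ₑ k (U ∪ e)
        ≡ U ⊆ᵇ (V ─ e) ∧ independentᵇ (map lift E₋ₑ) (true ∷ U) ∧ hasSize (k ∸ d) (true ∷ U)
    through-w {k} d≤k U = begin
      not (U meets e) ∧ (U ∪ e) ⊆ᵇ V ∧ rest
        ≡⟨ ∧-assoc (not (U meets e)) _ _ ⟨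
      (not (U meets e) ∧ (U ∪ e) ⊆ᵇ V) ∧ rest
        ≡⟨ cong (_∧ rest) (∪-⊆ᵇ-disjoint U e V e⊆ᵇV) ⟩
      U ⊆ᵇ (V ─ e) ∧ rest
        ≡⟨ ∧-cong-when (U ⊆ᵇ (V ─ e)) (λ U⊆V─e →
             cong₂ _∧_ (independent-through-w U) (hasSize-through-w d≤k U (⊆ᵇ-─-disjoint U e V U⊆V─e))) ⟩
      U ⊆ᵇ (V ─ e) ∧ independentᵇ (map lift E₋ₑ) (true ∷ U) ∧ hasSize (k ∸ d) (true ∷ U) ∎
      where
      rest : Bool
      rest = independentᵇ E₋ₑ (U ∪ e) ∧ hasSize k (U ∪ e)

  contract-count : ∀ {k} → d ≤ k →
    independentCount (suc n) (true ∷ (V ─ e)) (map lift E₋ₑ) (k ∸ d)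
      ≡ independentCount n (V ─ e) (filter avoids-e E) (k ∸ d) + containingEdge k
  contract-count {k} d≤k = cong₂ _+_
    (countSubsets-cong n λ U → cong (λ b → U ⊆ᵇ (V ─ e) ∧ b ∧ hasSize (k ∸ d) U) (independent-avoiding-w U))
    (sym (trans (countSubsets-shift n e (independentIn₋ₑ k)) (countSubsets-cong n (through-w d≤k))))

  coefficient-below : ∀ {k} → k < d → indPoly G k ≡ indPoly (deleteEdge G i) k ℤ.- ℤ.0ℤ ℤ.+ ℤ.0ℤ
  coefficient-below {k} k<d = begin
    indPoly G k                              ≡⟨ indPoly-independentCount n V E k ⟩
    ℤ.+ count                                ≡⟨ cong ℤ.+_ (+-identityʳ count) ⟨
    ℤ.+ (count + 0)                          ≡⟨ cong (λ b → ℤ.+ (count + b)) (containingEdge-small k<∣e∣) ⟨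
    ℤ.+ (count + containingEdge k)              ≡⟨ cong ℤ.+_ (deleteEdge-count k) ⟨
    ℤ.+ independentCount n V E₋ₑ k           ≡⟨ indPoly-independentCount n V E₋ₑ k ⟨
    indPoly (deleteEdge G i) k               ≡⟨ trans (ℤₚ.+-identityʳ _) (ℤₚ.+-identityʳ _) ⟨
    indPoly (deleteEdge G i) k ℤ.- ℤ.0ℤ ℤ.+ ℤ.0ℤ ∎
    where
    count : ℕ
    count = independentCount n V E k
    k<∣e∣ : k < ∣ e ∣
    k<∣e∣ = ≤-trans k<d (m∸n≤m ∣ e ∣ 1)

  coefficient-above : ∀ {k} → d ≤ k →
    indPoly G k ≡ indPoly (deleteEdge G i) k ℤ.- indPoly (contract G i) (k ∸ d) ℤ.+ indPoly (deleteVerticesOf G i) (k ∸ d)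
  coefficient-above {k} d≤k = begin
    indPoly G k                                      ≡⟨ indPoly-independentCount n V E k ⟩
    ℤ.+ count                                        ≡⟨ a≡a+b-[c+b]+c (ℤ.+ count) (ℤ.+ containingEdge k) (ℤ.+ avoiding) ⟩
    ℤ.+ (count + containingEdge k) ℤ.- ℤ.+ (avoiding + containingEdge k) ℤ.+ ℤ.+ avoiding
      ≡⟨ cong₂ (λ a b → a ℤ.- b ℤ.+ ℤ.+ avoiding) deleted contracted ⟨
    indPoly (deleteEdge G i) k ℤ.- indPoly (contract G i) (k ∸ d) ℤ.+ ℤ.+ avoiding
      ≡⟨ cong (λ c → indPoly (deleteEdge G i) k ℤ.- indPoly (contract G i) (k ∸ d) ℤ.+ c)
              (indPoly-independentCount n (V ─ e) (filter avoids-e E) (k ∸ d)) ⟨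
    indPoly (deleteEdge G i) k ℤ.- indPoly (contract G i) (k ∸ d) ℤ.+ indPoly (deleteVerticesOf G i) (k ∸ d) ∎
    where
    count avoiding : ℕ
    count    = independentCount n V E k
    avoiding = independentCount n (V ─ e) (filter avoids-e E) (k ∸ d)
    deleted : indPoly (deleteEdge G i) k ≡ ℤ.+ (count + containingEdge k)
    deleted = trans (indPoly-independentCount n V E₋ₑ k) (cong ℤ.+_ (deleteEdge-count k))
    contracted : indPoly (contract G i) (k ∸ d) ≡ ℤ.+ (avoiding + containingEdge k)
    contracted = trans (indPoly-independentCount (suc n) (true ∷ (V ─ e)) (map lift E₋ₑ) (k ∸ d))
                       (cong ℤ.+_ (contract-count d≤k))

mainTheorem10 : (G : Hypergraph) → IsHypergraph G → (e : Fin (length (E G))) →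
    indPoly G ≗ₚ (indPoly (deleteEdge G e) -ₚ (xpow* (∣ edge G e ∣ ∸ 1)) (indPoly (contract G e)) +ₚ (xpow* (∣ edge G e ∣ ∸ 1)) (indPoly (deleteVerticesOf G e)))
mainTheorem10 G@(hg n V E) wf i k with k <ᵇ ∣ edge G i ∣ ∸ 1 in k<ᵇd
... | true  = coefficient-below n V E i wf (<ᵇ⇒< k _ (Equivalence.from T-≡ k<ᵇd))
... | false = coefficient-above n V E i wf (≮⇒≥ λ k<d → subst T k<ᵇd (<⇒<ᵇ k<d))
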